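{- Let $G=(Q+S,E)$ be a split graph, with vertex set $V$ partitioned into a clique $Q$ and an independent set $S$, and suppose $G$ has no universal vertex. For $v\in Q$ let $N_v=V\setminus N(v)$. If for any two vertices $x,y\in S$ there is a vertex $v\in Q$ with $x,y\in N_v$, then the complete width of $G$ is $|Q|$; otherwise it is $|Q|+1$.
   Context: All graphs are finite, simple and undirected. $N(v)$ denotes the set of neighbours of $v$; a vertex is universal if it is adjacent to all other vertices. For a graph $G=(V,E)$, the complete width $cow(G)$ is the minimum $k\ge 0$ such that there exist $k$ independent sets $N_1,\dots,N_k\subseteq V$ with the property that for every two distinct non-adjacent vertices $x,y$ of $G$ there is an $i$ with $x,y\in N_i$. -}

module Defs where

open import Data.Nat using (ℕ; _≤_)
open import Data.Fin using (Fin)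
open import Data.Fin.Subset using (Subset; _∈_; _∉_; ∣_∣; ⊤)
open import Data.Bool using (Bool; true; false)
open import Data.Product using (Σ; ∃; _×_)
open import Data.Vec using (Vec; lookup)
open import Relation.Nullary using (¬_; Dec)
open import Relation.Binary.PropositionalEquality using (_≡_; _≢_)

record Graph (n : ℕ) : Set₁ where
  field
    Adj     : Fin n → Fin n → Set
    adj?    : ∀ x y → Dec (Adj x y)
    sym     : ∀ {x y} → Adj x y → Adj y x
    irrefl  : ∀ {x} → ¬ Adj x x
open Graph public

module _ {n : ℕ} (G : Graph n) where

  Universal : Fin n → Set
  Universal v = ∀ u → u ≢ v → Adj G u v

  HasNoUniversal : Set
  HasNoUniversal = ∀ v → ¬ Universal v

  IndependentSet : Subset n → Set
  IndependentSet A = ∀ x y → x ∈ A → y ∈ A → ¬ Adj G x y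

  CliqueSet : Subset n → Set
  CliqueSet A = ∀ x y → x ∈ A → y ∈ A → x ≢ y → Adj G x y

  CompleteWidthCover : ℕ → Set
  CompleteWidthCover k =
    Σ (Fin k → Subset n) λ N →
      (∀ i → IndependentSet (N i)) ×
      (∀ x y → x ≢ y → ¬ Adj G x y → ∃ λ i → x ∈ N i × y ∈ N i)

  CompleteWidthIs : ℕ → Set
  CompleteWidthIs k = CompleteWidthCover k × (∀ m → CompleteWidthCover m → k ≤ m)

  -- G is split with clique Q and independent set S = complement of Q
  -- (Q given as a subset; S is its complement, so V = Q + S)
  IsSplitPartition : Subset n → Set
  IsSplitPartition Q = CliqueSet Q × (∀ x y → x ∉ Q → y ∉ Q → ¬ Adj G x y)

  NonNbhd : Fin n → Fin n → Set
  NonNbhd v x = ¬ Adj G v x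

-- Upper bounds: the sets N_v (v ∈ Q) are independent, since Q is a clique and S is
-- independent; a non-adjacent pair meeting Q, say x ∈ Q, lies in N_x, so only pairs in S
-- may need the extra independent set S.
-- Lower bounds: every q ∈ Q has a non-neighbour, so q lies in some set of any cover, and
-- distinct q, q' ∈ Q, being adjacent, never share one; this injects Q into the cover.  If
-- two vertices x, y ∈ S have no common non-neighbour in Q, the set covering {x, y} contains
-- no vertex of Q at all and is missed by that injection.
module Submission where

open import Defs
open import Data.Nat using (ℕ; suc; _≤_; _<_; _≤?_)
open import Data.Fin using (Fin; zero; suc)
open import Data.Fin.Properties using (suc-injective; injective⇒≤; any?; ¬∀⟶∃¬; _≟_)
open import Data.Fin.Subset using (Subset; _∈_; _∉_; ∣_∣; ∁; inside; outside)
open import Data.Fin.Subset.Properties using (_∈?_; x∉p⇒x∈∁p; x∈∁p⇒x∉p)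
open import Data.Vec using ([]; _∷_; here; there; tabulate)
open import Data.Vec.Properties using (lookup⇒[]=; []=⇒lookup; lookup∘tabulate)
open import Data.Bool using (true)
open import Data.Product using (∃; _×_; _,_)
open import Data.Sum using (_⊎_; inj₁; inj₂)
open import Function using (_∘_)
open import Function.Definitions using (Injective)
open import Relation.Nullary using (¬_; Dec; yes; no; does; contradiction)
open import Relation.Nullary.Decidable using (¬?; _×-dec_; _→-dec_; decidable-stable)
open import Relation.Unary using (Pred; Decidable)
open import Relation.Binary.PropositionalEquality using (_≡_; _≢_; refl; cong; subst; trans)
  renaming (sym to ≡-sym)

record Enumeration {n : ℕ} (p : Subset n) : Set where
  field
    element            : Fin ∣ p ∣ → Fin n
    element∈           : ∀ i → element i ∈ p
    element-injective  : Injective _≡_ _≡_ element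
    element-surjective : ∀ {x} → x ∈ p → ∃ λ i → element i ≡ x

enumerate : ∀ {n} (p : Subset n) → Enumeration p
enumerate [] = record
  { element = λ () ; element∈ = λ () ; element-injective = λ {} ; element-surjective = λ () }
enumerate (outside ∷ p) = record
  { element            = suc ∘ element
  ; element∈           = there ∘ element∈
  ; element-injective  = element-injective ∘ suc-injective
  ; element-surjective = λ { (there x∈p) →
      let i , eq = element-surjective x∈p in i , cong suc eq }
  }
  where open Enumeration (enumerate p)
enumerate (inside ∷ p) = record
  { element            = element′
  ; element∈           = element′∈
  ; element-injective  = injective
  ; element-surjective = surjective
  }
  where
  open Enumeration (enumerate p)
  element′ : Fin (suc ∣ p ∣) → Fin _
  element′ zero    = zero
  element′ (suc i) = suc (element i)
  element′∈ : ∀ i → element′ i ∈ inside ∷ p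
  element′∈ zero    = here
  element′∈ (suc i) = there (element∈ i)
  injective : Injective _≡_ _≡_ element′
  injective {zero}  {zero}  _  = refl
  injective {suc i} {suc j} eq = cong suc (element-injective (suc-injective eq))
  surjective : ∀ {x} → x ∈ inside ∷ p → ∃ λ i → element′ i ≡ x
  surjective here        = zero , refl
  surjective (there x∈p) = let i , eq = element-surjective x∈p in suc i , cong suc eq

module _ {n m : ℕ} {p : Subset n} (f : ∀ x → x ∈ p → Fin m)
         (f-injective : ∀ {x y} x∈p y∈p → f x x∈p ≡ f y y∈p → x ≡ y) where

  open Enumeration (enumerate p)

  private
    f∘element : Fin ∣ p ∣ → Fin m
    f∘element i = f (element i) (element∈ i)

    f∘element-injective : Injective _≡_ _≡_ f∘element
    f∘element-injective = element-injective ∘ f-injective _ _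

  ∣p∣≤-by-injection : ∣ p ∣ ≤ m
  ∣p∣≤-by-injection = injective⇒≤ f∘element-injective

  ∣p∣<-by-non-surjective-injection : (j : Fin m) → (∀ x x∈p → f x x∈p ≢ j) → ∣ p ∣ < m
  ∣p∣<-by-non-surjective-injection j j∉image = injective⇒≤ extended-injective
    where
    extended : Fin (suc ∣ p ∣) → Fin m
    extended zero    = j
    extended (suc i) = f∘element i
    extended-injective : Injective _≡_ _≡_ extended
    extended-injective {zero}  {zero}  _  = refl
    extended-injective {zero}  {suc i} eq = contradiction (≡-sym eq) (j∉image _ _)
    extended-injective {suc i} {zero}  eq = contradiction eq (j∉image _ _)
    extended-injective {suc i} {suc k} eq = cong suc (f∘element-injective eq)

module _ {n ℓ} {P : Pred (Fin n) ℓ} (P? : Decidable P) where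

  select : Subset n
  select = tabulate (does ∘ P?)

  ∈-select⁺ : ∀ {x} → P x → x ∈ select
  ∈-select⁺ {x} px = lookup⇒[]= x select (trans (lookup∘tabulate _ x) (does-true (P? x)))
    where
    does-true : (d : Dec (P x)) → does d ≡ true
    does-true (yes _)  = refl
    does-true (no ¬px) = contradiction px ¬px

  ∈-select⁻ : ∀ {x} → x ∈ select → P x
  ∈-select⁻ {x} x∈ = witness (P? x) (trans (≡-sym (lookup∘tabulate _ x)) ([]=⇒lookup x∈))
    where
    witness : (d : Dec (P x)) → does d ≡ true → P x
    witness (yes px) _ = px

module _ {n : ℕ} (G : Graph n) where

  clique∩independent-subsingleton : ∀ {A B x y} → CliqueSet G A → IndependentSet G B →
    x ∈ A → y ∈ A → x ∈ B → y ∈ B → x ≡ y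
  clique∩independent-subsingleton {x = x} {y} clique indep x∈A y∈A x∈B y∈B with x ≟ y
  ... | yes x≡y = x≡y
  ... | no  x≢y = contradiction (clique x y x∈A y∈A x≢y) (indep x y x∈B y∈B)

  non-universal⇒non-neighbour : ∀ {v} → ¬ Universal G v → ∃ λ u → u ≢ v × ¬ Adj G u v
  non-universal⇒non-neighbour {v} ¬universal
    with u , ¬[u≢v⇒u~v] ← ¬∀⟶∃¬ n _ (λ u → ¬? (u ≟ v) →-dec adj? G u v) ¬universal
    = u , (λ u≡v → ¬[u≢v⇒u~v] (λ u≢v → contradiction u≡v u≢v))
        , (λ u~v → ¬[u≢v⇒u~v] (λ _ → u~v))

  Covers : ∀ {k} → (Fin k → Subset n) → Fin n → Fin n → Set
  Covers N x y = ∃ λ i → x ∈ N i × y ∈ N i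

  CoversNonAdjacentPairs : ∀ {k} → (Fin k → Subset n) → Set
  CoversNonAdjacentPairs N = ∀ x y → x ≢ y → ¬ Adj G x y → Covers N x y

  no-universal⇒cover-contains : HasNoUniversal G → ∀ {k} {N : Fin k → Subset n} →
    CoversNonAdjacentPairs N → ∀ v → ∃ λ i → v ∈ N i
  no-universal⇒cover-contains no-universal covers v
    with u , u≢v , u≁v ← non-universal⇒non-neighbour (no-universal v)
    with i , _ , v∈Nᵢ ← covers u v u≢v u≁v
    = i , v∈Nᵢ

  nonNbhd : Fin n → Subset n
  nonNbhd v = select (¬? ∘ adj? G v)

  ∈-nonNbhd⁺ : ∀ {v x} → ¬ Adj G v x → x ∈ nonNbhd v
  ∈-nonNbhd⁺ {v} = ∈-select⁺ (¬? ∘ adj? G v)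

  ∈-nonNbhd⁻ : ∀ {v x} → x ∈ nonNbhd v → ¬ Adj G v x
  ∈-nonNbhd⁻ {v} = ∈-select⁻ (¬? ∘ adj? G v)

module _ {n : ℕ} (G : Graph n) (Q : Subset n) (split : IsSplitPartition G Q) where

  private
    clique = let c , _ = split in c
    S-independent = let _ , s = split in s

  CommonNonNbhdInQ : Fin n → Fin n → Set
  CommonNonNbhdInQ x y = ∃ λ v → v ∈ Q × NonNbhd G v x × NonNbhd G v y

  SPairsHaveCommonNonNbhdInQ : Set
  SPairsHaveCommonNonNbhdInQ = ∀ x y → x ∉ Q → y ∉ Q → x ≢ y → CommonNonNbhdInQ x y

  nonNeighbour-in-Q⇒≡ : ∀ {v z} → v ∈ Q → z ∈ Q → ¬ Adj G v z → z ≡ v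
  nonNeighbour-in-Q⇒≡ {v} {z} v∈Q z∈Q v≁z with z ≟ v
  ... | yes z≡v = z≡v
  ... | no  z≢v = contradiction (clique v z v∈Q z∈Q (z≢v ∘ ≡-sym)) v≁z

  nonNbhd-independent : ∀ {v} → v ∈ Q → IndependentSet G (nonNbhd G v)
  nonNbhd-independent {v} v∈Q x y x∈N y∈N x~y with x ∈? Q | y ∈? Q
  ... | yes x∈Q | _       = ∈-nonNbhd⁻ G y∈N (subst (λ z → Adj G z y) x≡v x~y)
    where x≡v = nonNeighbour-in-Q⇒≡ v∈Q x∈Q (∈-nonNbhd⁻ G x∈N)
  ... | no _    | yes y∈Q = ∈-nonNbhd⁻ G x∈N (subst (λ z → Adj G z x) y≡v (sym G x~y))
    where y≡v = nonNeighbour-in-Q⇒≡ v∈Q y∈Q (∈-nonNbhd⁻ G y∈N)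
  ... | no x∉Q  | no y∉Q  = S-independent x y x∉Q y∉Q x~y

  open Enumeration (enumerate Q)

  nonNbhdFamily : Fin ∣ Q ∣ → Subset n
  nonNbhdFamily = nonNbhd G ∘ element

  nonNbhdFamily-independent : ∀ i → IndependentSet G (nonNbhdFamily i)
  nonNbhdFamily-independent = nonNbhd-independent ∘ element∈

  common-nonNbhd⇒covered : ∀ {v x y} → v ∈ Q → ¬ Adj G v x → ¬ Adj G v y →
    Covers G nonNbhdFamily x y
  common-nonNbhd⇒covered v∈Q v≁x v≁y with i , refl ← element-surjective v∈Q =
    i , ∈-nonNbhd⁺ G v≁x , ∈-nonNbhd⁺ G v≁y

  nonNbhdFamily-covers-or-in-S : ∀ {x y} → ¬ Adj G x y →
    Covers G nonNbhdFamily x y ⊎ (x ∉ Q × y ∉ Q)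
  nonNbhdFamily-covers-or-in-S {x} {y} x≁y with x ∈? Q | y ∈? Q
  ... | yes x∈Q | _       = inj₁ (common-nonNbhd⇒covered x∈Q (irrefl G) x≁y)
  ... | no _    | yes y∈Q = inj₁ (common-nonNbhd⇒covered y∈Q (x≁y ∘ sym G) (irrefl G))
  ... | no x∉Q  | no y∉Q  = inj₂ (x∉Q , y∉Q)

  nonNbhd-cover : SPairsHaveCommonNonNbhdInQ → CompleteWidthCover G ∣ Q ∣
  nonNbhd-cover common = nonNbhdFamily , nonNbhdFamily-independent , covers
    where
    covers : CoversNonAdjacentPairs G nonNbhdFamily
    covers x y x≢y x≁y with nonNbhdFamily-covers-or-in-S x≁y
    ... | inj₁ covered = covered
    ... | inj₂ (x∉Q , y∉Q) with v , v∈Q , v≁x , v≁y ← common x y x∉Q y∉Q x≢y =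
      common-nonNbhd⇒covered v∈Q v≁x v≁y

  nonNbhd-and-S-cover : CompleteWidthCover G (suc ∣ Q ∣)
  nonNbhd-and-S-cover = family , independent , covers
    where
    family : Fin (suc ∣ Q ∣) → Subset n
    family zero    = ∁ Q
    family (suc i) = nonNbhdFamily i
    independent : ∀ i → IndependentSet G (family i)
    independent zero x y x∈S y∈S = S-independent x y (x∈∁p⇒x∉p x∈S) (x∈∁p⇒x∉p y∈S)
    independent (suc i) = nonNbhdFamily-independent i
    covers : CoversNonAdjacentPairs G family
    covers x y _ x≁y with nonNbhdFamily-covers-or-in-S x≁y
    ... | inj₁ (i , x∈Nᵢ , y∈Nᵢ) = suc i , x∈Nᵢ , y∈Nᵢ
    ... | inj₂ (x∉Q , y∉Q)       = zero , x∉p⇒x∈∁p x∉Q , x∉p⇒x∈∁p y∉Q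

  module _ (no-universal : HasNoUniversal G) {m} {N : Fin m → Subset n}
           (N-independent : ∀ i → IndependentSet G (N i))
           (N-covers : CoversNonAdjacentPairs G N) where

    private
      index : ∀ q → q ∈ Q → Fin m
      index q _ = let i , _ = no-universal⇒cover-contains G no-universal N-covers q in i

      ∈-index : ∀ q q∈Q → q ∈ N (index q q∈Q)
      ∈-index q _ = let _ , q∈Nᵢ = no-universal⇒cover-contains G no-universal N-covers q in q∈Nᵢ

      index-injective : ∀ {q q′} q∈Q q′∈Q → index q q∈Q ≡ index q′ q′∈Q → q ≡ q′
      index-injective {q} {q′} q∈Q q′∈Q eq = clique∩independent-subsingleton G clique
        (N-independent _) q∈Q q′∈Q
        (∈-index q q∈Q) (subst (λ i → q′ ∈ N i) (≡-sym eq) (∈-index q′ q′∈Q))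

    ∣Q∣≤cover : ∣ Q ∣ ≤ m
    ∣Q∣≤cover = ∣p∣≤-by-injection index index-injective

    S-pair-without-common-nonNbhd⇒∣Q∣<cover : ∀ {x y} → x ∉ Q → y ∉ Q → x ≢ y →
      ¬ CommonNonNbhdInQ x y → ∣ Q ∣ < m
    S-pair-without-common-nonNbhd⇒∣Q∣<cover {x} {y} x∉Q y∉Q x≢y ¬common
      with j , x∈Nⱼ , y∈Nⱼ ← N-covers x y x≢y (S-independent x y x∉Q y∉Q) =
      ∣p∣<-by-non-surjective-injection index index-injective j j∉image
      where
      j∉image : ∀ q q∈Q → index q q∈Q ≢ j
      j∉image q q∈Q eq =
        ¬common (q , q∈Q , N-independent j q x q∈Nⱼ x∈Nⱼ , N-independent j q y q∈Nⱼ y∈Nⱼ)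
        where q∈Nⱼ = subst (λ i → q ∈ N i) eq (∈-index q q∈Q)

    -- Constructively ¬ SPairsHaveCommonNonNbhdInQ yields no witness pair; since both
    -- ∣ Q ∣ < m and the existence of a common non-neighbour are decidable, we may argue
    -- by contradiction instead.
    ¬SPairsHaveCommonNonNbhdInQ⇒∣Q∣<cover : ¬ SPairsHaveCommonNonNbhdInQ → ∣ Q ∣ < m
    ¬SPairsHaveCommonNonNbhdInQ⇒∣Q∣<cover ¬common = decidable-stable (suc ∣ Q ∣ ≤? m) λ ∣Q∣≮m →
      ¬common λ x y x∉Q y∉Q x≢y → decidable-stable (common? x y)
        (∣Q∣≮m ∘ S-pair-without-common-nonNbhd⇒∣Q∣<cover x∉Q y∉Q x≢y)
      where
      common? : ∀ x y → Dec (CommonNonNbhdInQ x y)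
      common? x y = any? λ v → v ∈? Q ×-dec ¬? (adj? G v x) ×-dec ¬? (adj? G v y)

lemma1 : ∀ {n : ℕ} (G : Graph n) (Q : Subset n) →
         IsSplitPartition G Q →
         HasNoUniversal G →
         ((∀ x y → x ∉ Q → y ∉ Q → x ≢ y →
             ∃ λ v → v ∈ Q × NonNbhd G v x × NonNbhd G v y) →
            CompleteWidthIs G ∣ Q ∣)
         ×
         (¬ (∀ x y → x ∉ Q → y ∉ Q → x ≢ y →
             ∃ λ v → v ∈ Q × NonNbhd G v x × NonNbhd G v y) →
            CompleteWidthIs G (suc ∣ Q ∣))
lemma1 G Q split no-universal =
  (λ common → nonNbhd-cover G Q split common ,
     λ { _ (_ , independent , covers) → ∣Q∣≤cover G Q split no-universal independent covers }) ,
  (λ ¬common → nonNbhd-and-S-cover G Q split ,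
     λ { _ (_ , independent , covers) →
           ¬SPairsHaveCommonNonNbhdInQ⇒∣Q∣<cover G Q split no-universal
             independent covers ¬common })
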